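{- Let $\mathbf{A}$ be a Boolean algebra, regarded as a BL-algebra (with $a\ast b=a\wedge b$ and $a\to b=\neg a\vee b$), and let $\forall,\exists$ be unary operations on $A$. If $\langle\mathbf{A},\forall,\exists\rangle$ is an Epistemic BL-algebra, then $\langle\mathbf{A},\exists\rangle$ is a pseudomonadic algebra. Conversely, if $\langle\mathbf{A},\exists\rangle$ is a pseudomonadic algebra and $\forall a=\neg\exists\neg a$ for all $a\in A$, then $\langle\mathbf{A},\forall,\exists\rangle$ is an Epistemic BL-algebra.
   Context: A BL-algebra is an algebra $\langle A,\wedge,\vee,\ast,\to,0,1\rangle$ such that $\langle A,\wedge,\vee,0,1\rangle$ is a bounded lattice (with order $\le$), $\langle A,\ast,1\rangle$ is a commutative monoid, $a\ast b\le c$ iff $a\le b\to c$, and $a\wedge b=a\ast(a\to b)$ and $(a\to b)\vee(b\to a)=1$ hold; $\neg a:=a\to 0$. An Epistemic BL-algebra is a BL-algebra with unary operations $\forall,\exists$ satisfying, for all $a,b$: $\forall 1=1$; $\exists 0=0$; $\forall a\to\exists a=1$; $\forall(a\to\forall b)=\exists a\to\forall b$; $\forall(\forall a\to b)=\forall a\to\forall b$; $\exists a\to\forall\exists a=1$; $\forall(a\wedge b)=\forall a\wedge\forall b$; $\exists(a\vee b)=\exists a\vee\exists b$; $\exists(a\ast\exists b)=\exists a\ast\exists b$. A pseudomonadic algebra is a pair $\langle\mathbf{B},\exists\rangle$ with $\mathbf{B}$ a Boolean algebra and $\exists$ a unary operation such that for all $a,b$: (P1) $\exists 0=0$; (P2)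 $\exists(a\vee b)=\exists a\vee\exists b$; (P3) $\exists(\exists a\wedge b)=\exists a\wedge\exists b$; (P4) $\neg\exists a\le\exists\neg a$. -}

module Defs where

open import Level using (Level)
open import Algebra.Lattice.Bundles using (BooleanAlgebra)
open import Algebra.Core using (Op₁)
open import Data.Product using (_×_)
open import Relation.Binary.Core using (Rel)

module BLOps {c ℓ : Level} (B : BooleanAlgebra c ℓ) where
  open BooleanAlgebra B

  _∗_ : Carrier → Carrier → Carrier
  a ∗ b = a ∧ b

  _⇒_ : Carrier → Carrier → Carrier
  a ⇒ b = (¬ a) ∨ b

  _≤_ : Rel Carrier ℓ
  a ≤ b = (a ∧ b) ≈ a

  Congruent₁ : Op₁ Carrier → Set (c Level.⊔ ℓ)
  Congruent₁ f = ∀ {a b} → a ≈ b → f a ≈ f b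

open BLOps public

record IsEpistemic {c ℓ : Level} (B : BooleanAlgebra c ℓ) (A E : Op₁ (BooleanAlgebra.Carrier B)) : Set (c Level.⊔ ℓ) where
  open BooleanAlgebra B
  field
    A-cong : Congruent₁ B A
    E-cong : Congruent₁ B E
    e1 : A ⊤ ≈ ⊤
    e2 : E ⊥ ≈ ⊥
    e3 : ∀ a → _⇒_ B (A a) (E a) ≈ ⊤
    e4 : ∀ a b → A (_⇒_ B a (A b)) ≈ _⇒_ B (E a) (A b)
    e5 : ∀ a b → A (_⇒_ B (A a) b) ≈ _⇒_ B (A a) (A b)
    e6 : ∀ a → _⇒_ B (E a) (A (E a)) ≈ ⊤
    e7 : ∀ a b → A (a ∧ b) ≈ (A a ∧ A b)
    e8 : ∀ a b → E (a ∨ b) ≈ (E a ∨ E b)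
    e9 : ∀ a b → E (_∗_ B a (E b)) ≈ _∗_ B (E a) (E b)

record IsPseudomonadic {c ℓ : Level} (B : BooleanAlgebra c ℓ) (E : Op₁ (BooleanAlgebra.Carrier B)) : Set (c Level.⊔ ℓ) where
  open BooleanAlgebra B
  field
    E-cong : Congruent₁ B E
    p1 : E ⊥ ≈ ⊥
    p2 : ∀ a b → E (a ∨ b) ≈ (E a ∨ E b)
    p3 : ∀ a b → E (E a ∧ b) ≈ (E a ∧ E b)
    p4 : ∀ a → _≤_ B (¬ (E a)) (E (¬ a))

-- (e1) and (e3) give ∃⊤ = ⊤, hence ∃a ∨ ∃¬a = ⊤, which in a Boolean algebra is (P4); (P3) is
-- (e9) up to commutativity. Conversely, with ∀ = ¬∃¬ most epistemic axioms are De Morgan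
-- duals of (P1)–(P3); (e5) and (e6) rest on the fact that ∃ fixes ¬∃c. Indeed, by (P3),
-- ∃∃c = ∃c and ∃c ∧ ∃¬∃c = ∃⊥ = ⊥, so ∃¬∃c ≤ ¬∃c, while (P4) at ∃c gives ¬∃c ≤ ∃¬∃c.
module Submission where

open import Defs using (IsEpistemic; IsPseudomonadic; module BLOps)
open import Level using (Level)
open import Algebra.Lattice.Bundles using (BooleanAlgebra)
open import Algebra.Core using (Op₁)
open import Data.Product using (_×_; _,_)
import Algebra.Lattice.Properties.BooleanAlgebra as BooleanAlgebraProperties
import Relation.Binary.Reasoning.Setoid as SetoidReasoning

module BooleanOrder {c ℓ : Level} (B : BooleanAlgebra c ℓ) where
  open BooleanAlgebra B
  open BooleanAlgebraProperties B
  open BLOps B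
  open SetoidReasoning setoid

  x∨y≈⊤⇒¬x≤y : ∀ {x y} → x ∨ y ≈ ⊤ → (¬ x) ≤ y
  x∨y≈⊤⇒¬x≤y {x} {y} x∨y≈⊤ = begin
    ¬ x ∧ y                ≈⟨ ∨-identityʳ _ ⟨
    (¬ x ∧ y) ∨ ⊥          ≈⟨ ∨-congˡ (∧-complementˡ x) ⟨
    (¬ x ∧ y) ∨ (¬ x ∧ x)  ≈⟨ ∧-distribˡ-∨ (¬ x) y x ⟨
    ¬ x ∧ (y ∨ x)          ≈⟨ ∧-congˡ (trans (∨-comm y x) x∨y≈⊤) ⟩
    ¬ x ∧ ⊤                ≈⟨ ∧-identityʳ _ ⟩
    ¬ x                    ∎

  x∧y≈⊥⇒y≤¬x : ∀ {x y} → x ∧ y ≈ ⊥ → y ≤ (¬ x)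
  x∧y≈⊥⇒y≤¬x {x} {y} x∧y≈⊥ = begin
    y ∧ ¬ x                ≈⟨ ∨-identityʳ _ ⟨
    (y ∧ ¬ x) ∨ ⊥          ≈⟨ ∨-congˡ (trans (∧-comm y x) x∧y≈⊥) ⟨
    (y ∧ ¬ x) ∨ (y ∧ x)    ≈⟨ ∧-distribˡ-∨ y (¬ x) x ⟨
    y ∧ (¬ x ∨ x)          ≈⟨ ∧-congˡ (∨-complementˡ x) ⟩
    y ∧ ⊤                  ≈⟨ ∧-identityʳ _ ⟩
    y                      ∎

  ≤-antisym : ∀ {x y} → x ≤ y → y ≤ x → x ≈ y
  ≤-antisym {x} {y} x≤y y≤x = begin
    x      ≈⟨ x≤y ⟨
    x ∧ y  ≈⟨ ∧-comm x y ⟩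
    y ∧ x  ≈⟨ y≤x ⟩
    y      ∎

module EpistemicToPseudomonadic {c ℓ : Level} (B : BooleanAlgebra c ℓ)
                                {A E : Op₁ (BooleanAlgebra.Carrier B)}
                                (epistemic : IsEpistemic B A E) where
  open BooleanAlgebra B
  open BooleanAlgebraProperties B
  open BooleanOrder B
  open IsEpistemic epistemic
  open SetoidReasoning setoid

  E⊤≈⊤ : E ⊤ ≈ ⊤
  E⊤≈⊤ = begin
    E ⊤            ≈⟨ ∨-identityˡ _ ⟨
    ⊥ ∨ E ⊤        ≈⟨ ∨-congʳ (trans (¬-cong e1) ¬⊤≈⊥) ⟨
    ¬ (A ⊤) ∨ E ⊤  ≈⟨ e3 ⊤ ⟩
    ⊤              ∎

  E-∨-E¬≈⊤ : ∀ a → E a ∨ E (¬ a) ≈ ⊤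
  E-∨-E¬≈⊤ a = begin
    E a ∨ E (¬ a)  ≈⟨ e8 a (¬ a) ⟨
    E (a ∨ ¬ a)    ≈⟨ E-cong (∨-complementʳ a) ⟩
    E ⊤            ≈⟨ E⊤≈⊤ ⟩
    ⊤              ∎

  isPseudomonadic : IsPseudomonadic B E
  isPseudomonadic = record
    { E-cong = E-cong
    ; p1     = e2
    ; p2     = e8
    ; p3     = λ a b → trans (E-cong (∧-comm (E a) b)) (trans (e9 b a) (∧-comm (E b) (E a)))
    ; p4     = λ a → x∨y≈⊤⇒¬x≤y (E-∨-E¬≈⊤ a)
    }

module PseudomonadicProperties {c ℓ : Level} (B : BooleanAlgebra c ℓ)
                               {E : Op₁ (BooleanAlgebra.Carrier B)}
                               (pseudomonadic : IsPseudomonadic B E) where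
  open BooleanAlgebra B
  open BooleanAlgebraProperties B
  open BooleanOrder B
  open IsPseudomonadic pseudomonadic
  open SetoidReasoning setoid

  ¬E⊥≈⊤ : ¬ E ⊥ ≈ ⊤
  ¬E⊥≈⊤ = trans (¬-cong p1) ¬⊥≈⊤

  E⊤≈⊤ : E ⊤ ≈ ⊤
  E⊤≈⊤ = begin
    E ⊤              ≈⟨ ∧-identityˡ _ ⟨
    ⊤ ∧ E ⊤          ≈⟨ ∧-cong ¬E⊥≈⊤ (E-cong ¬⊥≈⊤) ⟨
    ¬ E ⊥ ∧ E (¬ ⊥)  ≈⟨ p4 ⊥ ⟩
    ¬ E ⊥            ≈⟨ ¬E⊥≈⊤ ⟩
    ⊤                ∎

  E-idem : ∀ a → E (E a) ≈ E a
  E-idem a = begin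
    E (E a)      ≈⟨ E-cong (∧-identityʳ (E a)) ⟨
    E (E a ∧ ⊤)  ≈⟨ p3 a ⊤ ⟩
    E a ∧ E ⊤    ≈⟨ ∧-congˡ E⊤≈⊤ ⟩
    E a ∧ ⊤      ≈⟨ ∧-identityʳ (E a) ⟩
    E a          ∎

  E¬E≈¬E : ∀ a → E (¬ E a) ≈ ¬ E a
  E¬E≈¬E a = ≤-antisym (x∧y≈⊥⇒y≤¬x disjoint) ¬E≤E¬E
    where
    disjoint : E a ∧ E (¬ E a) ≈ ⊥
    disjoint = begin
      E a ∧ E (¬ E a)  ≈⟨ p3 a (¬ E a) ⟨
      E (E a ∧ ¬ E a)  ≈⟨ E-cong (∧-complementʳ (E a)) ⟩
      E ⊥              ≈⟨ p1 ⟩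
      ⊥                ∎
    ¬E≤E¬E : ¬ E a ∧ E (¬ E a) ≈ ¬ E a
    ¬E≤E¬E = begin
      ¬ E a ∧ E (¬ E a)      ≈⟨ ∧-congʳ (¬-cong (E-idem a)) ⟨
      ¬ E (E a) ∧ E (¬ E a)  ≈⟨ p4 (E a) ⟩
      ¬ E (E a)              ≈⟨ ¬-cong (E-idem a) ⟩
      ¬ E a                  ∎

  E-∧-fixedˡ : ∀ {x} d → E x ≈ x → E (x ∧ d) ≈ x ∧ E d
  E-∧-fixedˡ {x} d Ex≈x = begin
    E (x ∧ d)      ≈⟨ E-cong (∧-congʳ Ex≈x) ⟨
    E (E x ∧ d)    ≈⟨ p3 x d ⟩
    E x ∧ E d      ≈⟨ ∧-congʳ Ex≈x ⟩
    x ∧ E d        ∎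

  E-∧-¬E : ∀ a d → E (¬ E a ∧ d) ≈ ¬ E a ∧ E d
  E-∧-¬E a d = E-∧-fixedˡ d (E¬E≈¬E a)

  E-∧-E : ∀ a b → E (a ∧ E b) ≈ E a ∧ E b
  E-∧-E a b = trans (E-cong (∧-comm a (E b))) (trans (p3 b a) (∧-comm (E b) (E a)))

module PseudomonadicToEpistemic {c ℓ : Level} (B : BooleanAlgebra c ℓ)
                                {A E : Op₁ (BooleanAlgebra.Carrier B)}
                                (pseudomonadic : IsPseudomonadic B E)
                                (A≈¬E¬ : ∀ a → BooleanAlgebra._≈_ B (A a) (BooleanAlgebra.¬_ B (E (BooleanAlgebra.¬_ B a))))
                                where
  open BooleanAlgebra B
  open BooleanAlgebraProperties B
  open IsPseudomonadic pseudomonadic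
  open PseudomonadicProperties B pseudomonadic
  open SetoidReasoning setoid

  A-cong : ∀ {a b} → a ≈ b → A a ≈ A b
  A-cong {a} {b} a≈b = trans (A≈¬E¬ a) (trans (¬-cong (E-cong (¬-cong a≈b))) (sym (A≈¬E¬ b)))

  ¬A≈E¬ : ∀ a → ¬ A a ≈ E (¬ a)
  ¬A≈E¬ a = trans (¬-cong (A≈¬E¬ a)) (¬-involutive _)

  A⊤≈⊤ : A ⊤ ≈ ⊤
  A⊤≈⊤ = begin
    A ⊤          ≈⟨ A≈¬E¬ ⊤ ⟩
    ¬ E (¬ ⊤)    ≈⟨ ¬-cong (E-cong ¬⊤≈⊥) ⟩
    ¬ E ⊥        ≈⟨ ¬E⊥≈⊤ ⟩
    ⊤            ∎

  ¬A∨E≈⊤ : ∀ a → ¬ A a ∨ E a ≈ ⊤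
  ¬A∨E≈⊤ a = begin
    ¬ A a ∨ E a      ≈⟨ ∨-congʳ (¬A≈E¬ a) ⟩
    E (¬ a) ∨ E a    ≈⟨ p2 (¬ a) a ⟨
    E (¬ a ∨ a)      ≈⟨ E-cong (∨-complementˡ a) ⟩
    E ⊤              ≈⟨ E⊤≈⊤ ⟩
    ⊤                ∎

  A-⇒-A : ∀ a b → A (¬ a ∨ A b) ≈ ¬ E a ∨ A b
  A-⇒-A a b = begin
    A (¬ a ∨ A b)              ≈⟨ A≈¬E¬ _ ⟩
    ¬ E (¬ (¬ a ∨ A b))        ≈⟨ ¬-cong (E-cong (deMorgan₂ _ _)) ⟩
    ¬ E (¬ ¬ a ∧ ¬ A b)        ≈⟨ ¬-cong (E-cong (∧-cong (¬-involutive a) (¬A≈E¬ b))) ⟩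
    ¬ E (a ∧ E (¬ b))          ≈⟨ ¬-cong (E-∧-E a (¬ b)) ⟩
    ¬ (E a ∧ E (¬ b))          ≈⟨ deMorgan₁ _ _ ⟩
    ¬ E a ∨ ¬ E (¬ b)          ≈⟨ ∨-congˡ (A≈¬E¬ b) ⟨
    ¬ E a ∨ A b                ∎

  A-A⇒ : ∀ a b → A (¬ A a ∨ b) ≈ ¬ A a ∨ A b
  A-A⇒ a b = begin
    A (¬ A a ∨ b)              ≈⟨ A≈¬E¬ _ ⟩
    ¬ E (¬ (¬ A a ∨ b))        ≈⟨ ¬-cong (E-cong (deMorgan₂ _ _)) ⟩
    ¬ E (¬ ¬ A a ∧ ¬ b)        ≈⟨ ¬-cong (E-cong (∧-congʳ (trans (¬-involutive _) (A≈¬E¬ a)))) ⟩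
    ¬ E (¬ E (¬ a) ∧ ¬ b)      ≈⟨ ¬-cong (E-∧-¬E (¬ a) (¬ b)) ⟩
    ¬ (¬ E (¬ a) ∧ E (¬ b))    ≈⟨ deMorgan₁ _ _ ⟩
    ¬ ¬ E (¬ a) ∨ ¬ E (¬ b)    ≈⟨ ∨-cong (¬-cong (A≈¬E¬ a)) (A≈¬E¬ b) ⟨
    ¬ A a ∨ A b                ∎

  ¬E∨AE≈⊤ : ∀ a → ¬ E a ∨ A (E a) ≈ ⊤
  ¬E∨AE≈⊤ a = begin
    ¬ E a ∨ A (E a)          ≈⟨ ∨-congˡ (A≈¬E¬ (E a)) ⟩
    ¬ E a ∨ ¬ E (¬ E a)      ≈⟨ ∨-congˡ (¬-cong (E¬E≈¬E a)) ⟩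
    ¬ E a ∨ ¬ ¬ E a          ≈⟨ ∨-complementʳ (¬ E a) ⟩
    ⊤                        ∎

  A-∧ : ∀ a b → A (a ∧ b) ≈ A a ∧ A b
  A-∧ a b = begin
    A (a ∧ b)                  ≈⟨ A≈¬E¬ _ ⟩
    ¬ E (¬ (a ∧ b))            ≈⟨ ¬-cong (E-cong (deMorgan₁ a b)) ⟩
    ¬ E (¬ a ∨ ¬ b)            ≈⟨ ¬-cong (p2 _ _) ⟩
    ¬ (E (¬ a) ∨ E (¬ b))      ≈⟨ deMorgan₂ _ _ ⟩
    ¬ E (¬ a) ∧ ¬ E (¬ b)      ≈⟨ ∧-cong (A≈¬E¬ a) (A≈¬E¬ b) ⟨
    A a ∧ A b                  ∎

  isEpistemic : IsEpistemic B A E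
  isEpistemic = record
    { A-cong = A-cong
    ; E-cong = E-cong
    ; e1     = A⊤≈⊤
    ; e2     = p1
    ; e3     = ¬A∨E≈⊤
    ; e4     = A-⇒-A
    ; e5     = A-A⇒
    ; e6     = ¬E∨AE≈⊤
    ; e7     = A-∧
    ; e8     = p2
    ; e9     = E-∧-E
    }

theorem3 : ∀ {c ℓ : Level} (B : BooleanAlgebra c ℓ)
    → (A E : Op₁ (BooleanAlgebra.Carrier B))
    → (IsEpistemic B A E → IsPseudomonadic B E)
      × (IsPseudomonadic B E
         → (∀ a → BooleanAlgebra._≈_ B (A a) (BooleanAlgebra.¬_ B (E (BooleanAlgebra.¬_ B a))))
         → IsEpistemic B A E)
theorem3 B A E =
  EpistemicToPseudomonadic.isPseudomonadic B , PseudomonadicToEpistemic.isEpistemic B
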